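{- Let $m \geq 5$ be odd. The Cayley graph $\mathrm{Cay}(\mathbb{Z}_m \times \mathbb{Z}_8, \{\pm 1\}\times\{\pm 1, 4\})$ can be decomposed (its edge set partitioned) into two $C_8$-factors and one $C_m$-factor.
   Context: For a finite additive group $\Gamma$ and a subset $S\subseteq \Gamma\setminus\{0\}$ with $S=-S$, the Cayley graph $\mathrm{Cay}(\Gamma,S)$ has vertex set $\Gamma$ and edge set $\{\{x,y\}: x,y\in\Gamma,\ x-y\in S\}$. Here $\{\pm 1\}\times\{\pm 1,4\}=\{(\epsilon,c): \epsilon\in\{1,-1\},\ c\in\{1,-1,4\}\}\subseteq \mathbb{Z}_m\times\mathbb{Z}_8$. A $C_k$-factor of a graph is a spanning subgraph each of whose components is a cycle of length $k$. -}

module Defs where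

open import Data.Nat using (ℕ; zero; suc; _+_; _∸_; _%_; NonZero; _≤_)
open import Data.Nat.DivMod using (m%n<n)
open import Data.Fin using (Fin; toℕ; fromℕ<)
open import Data.Product using (_×_; _,_; proj₁; proj₂; ∃; ∃-syntax)
open import Data.Sum using (_⊎_)
open import Relation.Binary.PropositionalEquality using (_≡_)
open import Relation.Nullary using (¬_)
open import Function.Definitions using (Bijective)

[_]_ : ℕ → (n : ℕ) → .{{NonZero n}} → Fin n
[ a ] n = fromℕ< (m%n<n a n)

sub : (n : ℕ) → .{{NonZero n}} → Fin n → Fin n → Fin n
sub n x y = [ toℕ x + (n ∸ toℕ y) ] n

Γ : ℕ → Set
Γ m = Fin m × Fin 8

subΓ : (m : ℕ) → .{{NonZero m}} → Γ m → Γ m → Γ m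
subΓ m (x₁ , x₂) (y₁ , y₂) = sub m x₁ y₁ , sub 8 x₂ y₂

S : (m : ℕ) → .{{NonZero m}} → Γ m → Set
S m (a , c) =
  (a ≡ [ 1 ] m ⊎ a ≡ [ m ∸ 1 ] m) ×
  (c ≡ [ 1 ] 8 ⊎ c ≡ [ 7 ] 8 ⊎ c ≡ [ 4 ] 8)

CayAdj : (m : ℕ) → .{{NonZero m}} → Γ m → Γ m → Set
CayAdj m x y = S m (subΓ m x y)

csuc : ∀ {k} → Fin k → Fin k
csuc {suc k} i = [ suc (toℕ i) ] (suc k)

record CFactor {V : Set} (Adj : V → V → Set) (k : ℕ) : Set₁ where
  field
    t     : ℕ
    cyc   : Fin t → Fin k → V
    cover : Bijective _≡_ _≡_ (λ (p : Fin t × Fin k) → cyc (proj₁ p) (proj₂ p))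
    edges : ∀ j i → Adj (cyc j i) (cyc j (csuc i))

  Edge : V → V → Set
  Edge x y = ∃[ j ] ∃[ i ]
    ((x ≡ cyc j i × y ≡ cyc j (csuc i)) ⊎ (y ≡ cyc j i × x ≡ cyc j (csuc i)))

open CFactor public

record Decomp {V : Set} (Adj : V → V → Set) (k l : ℕ) : Set₁ where
  field
    F₁ : CFactor Adj k
    F₂ : CFactor Adj k
    F₃ : CFactor Adj l
    covered : ∀ x y → Adj x y → Edge F₁ x y ⊎ Edge F₂ x y ⊎ Edge F₃ x y
    disj₁₂  : ∀ x y → ¬ (Edge F₁ x y × Edge F₂ x y)
    disj₁₃  : ∀ x y → ¬ (Edge F₁ x y × Edge F₃ x y)
    disj₂₃  : ∀ x y → ¬ (Edge F₂ x y × Edge F₃ x y)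

module Submission where

-- Think of a vertex (a , c) as the label c in column a.  Every edge joins two consecutive
-- columns and is an arc (a , c) → (a + 1 , c + s) with a shift s ∈ {1, −1, 4}.  The arcs are
-- coloured red, blue and green by a rule that depends only on the column class (0, 1, 2, 3
-- or ≥ 4), the label and the shift.  Green arcs shift by 1 out of columns 0–3 and by 4 out of
-- the others, so one turn around ℤ_m shifts labels by 4 + 4(m − 4) ≡ 0 (mod 8) when m is odd:
-- the green arcs form eight m-cycles.  The red arcs, and likewise the blue ones, form four
-- 8-cycles inside columns 0–4 (the "segments", translates of each other by 2), and between
-- every column j ≥ 4 and j + 1 one 8-cycle zig-zagging between the two columns (a "band").
-- Everything about these 8-cycles that does not involve m is a statement about a local model
-- with columns 0–5, checked by enumeration, and is transported to ℤ_m × ℤ_8 by placing the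
-- local columns.

open import Defs
open import Data.Nat using (ℕ; zero; suc; _+_; _∸_; _*_; _%_; _≤_; _<_; z≤n; s≤s; s≤s⁻¹; NonZero)
open import Data.Nat.Properties
  using ( +-comm; +-assoc; +-suc; m∸n+n≡m; <⇒≤; m≤n⇒m<n∨m≡n; suc-injective; <⇒≢; m<n⇒m<1+n
        ; n<1+n; _≤?_; _<?_; <⇒≱; ≮⇒≥; ≤-refl; ≤-reflexive; ≤-trans; n≤1+n; m≤m+n )
  renaming (_≟_ to _≟ⁿ_)
open import Data.Nat.DivMod
  using (m%n<n; m<n⇒m%n≡m; [m+n]%n≡m%n; %-distribˡ-+; m%n%n≡m%n; n%n≡0)
open import Data.Fin using (Fin; zero; suc; toℕ; #_; fromℕ<)
open import Data.Fin.Properties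
  using (toℕ-fromℕ<; toℕ-injective; toℕ<n; all?; any?)
  renaming (_≟_ to _≟ᶠ_)
open import Data.Vec using (_∷_; []; lookup)
open import Data.Product using (_×_; _,_; proj₁; proj₂; ∃; ∃-syntax)
open import Data.Product.Properties using (≡-dec)
open import Data.Sum using (_⊎_; inj₁; inj₂)
open import Data.Empty using (⊥-elim)
open import Function.Definitions using (Bijective)
open import Function.Consequences.Propositional
  using (inverseᵇ⇒bijective; strictlyInverseˡ⇒inverseˡ; strictlyInverseʳ⇒inverseʳ)
open import Relation.Nullary using (Dec; yes; no; contradiction)
open import Relation.Nullary.Decidable using (from-yes; _×-dec_; _⊎-dec_; _→-dec_; map′)
open import Relation.Binary.PropositionalEquality hiding ([_])

inverse⇒bijective : ∀ {A B : Set} (f : A → B) (g : B → A) →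
                    (∀ y → f (g y) ≡ y) → (∀ x → g (f x) ≡ x) → Bijective _≡_ _≡_ f
inverse⇒bijective f g fg gf =
  inverseᵇ⇒bijective (strictlyInverseˡ⇒inverseˡ f fg , strictlyInverseʳ⇒inverseʳ f gf)

-- The cyclic group ℤ_m, m = n + 1

module CyclicGroup (n : ℕ) where

  m : ℕ
  m = suc n

  cpred : Fin m → Fin m
  cpred a = [ n + toℕ a ] m

  toℕ-[] : ∀ k → toℕ ([ k ] m) ≡ k % m
  toℕ-[] k = toℕ-fromℕ< (m%n<n k m)

  toℕ-[]-< : ∀ {k} → k < m → toℕ ([ k ] m) ≡ k
  toℕ-[]-< {k} k<m = trans (toℕ-[] k) (m<n⇒m%n≡m k<m)

  []-cong : ∀ k l → k % m ≡ l % m → [ k ] m ≡ [ l ] m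
  []-cong k l eq = toℕ-injective (trans (toℕ-[] k) (trans eq (sym (toℕ-[] l))))

  []-toℕ : ∀ a → [ toℕ a ] m ≡ a
  []-toℕ a = toℕ-injective (toℕ-[]-< (toℕ<n a))

  [m+k]≡[k] : ∀ k → [ m + k ] m ≡ [ k ] m
  [m+k]≡[k] k = []-cong (m + k) k (trans (cong (_% m) (+-comm m k)) ([m+n]%n≡m%n k m))

  [k+l%m]≡[k+l] : ∀ k l → [ k + l % m ] m ≡ [ k + l ] m
  [k+l%m]≡[k+l] k l = []-cong (k + l % m) (k + l) (begin
    (k + l % m) % m         ≡⟨ %-distribˡ-+ k (l % m) m ⟩
    (k % m + l % m % m) % m ≡⟨ cong (λ r → (k % m + r) % m) (m%n%n≡m%n l m) ⟩
    (k % m + l % m) % m     ≡⟨ %-distribˡ-+ k l m ⟨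
    (k + l) % m             ∎)
    where open ≡-Reasoning

  csuc-cpred : ∀ a → csuc (cpred a) ≡ a
  csuc-cpred a = begin
    [ 1 + toℕ ([ n + toℕ a ] m) ] m ≡⟨ cong (λ r → [ 1 + r ] m) (toℕ-[] (n + toℕ a)) ⟩
    [ 1 + (n + toℕ a) % m ] m       ≡⟨ [k+l%m]≡[k+l] 1 (n + toℕ a) ⟩
    [ m + toℕ a ] m                 ≡⟨ [m+k]≡[k] (toℕ a) ⟩
    [ toℕ a ] m                     ≡⟨ []-toℕ a ⟩
    a                               ∎
    where open ≡-Reasoning

  cpred-csuc : ∀ a → cpred (csuc a) ≡ a
  cpred-csuc a = begin
    [ n + toℕ ([ 1 + toℕ a ] m) ] m ≡⟨ cong (λ r → [ n + r ] m) (toℕ-[] (1 + toℕ a)) ⟩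
    [ n + (1 + toℕ a) % m ] m       ≡⟨ [k+l%m]≡[k+l] n (1 + toℕ a) ⟩
    [ n + suc (toℕ a) ] m           ≡⟨ cong (λ r → [ r ] m) (+-suc n (toℕ a)) ⟩
    [ m + toℕ a ] m                 ≡⟨ [m+k]≡[k] (toℕ a) ⟩
    [ toℕ a ] m                     ≡⟨ []-toℕ a ⟩
    a                               ∎
    where open ≡-Reasoning

  data CsucView (a : Fin m) : Set where
    interior : toℕ (csuc a) ≡ suc (toℕ a) → CsucView a
    wrap     : toℕ a ≡ n → toℕ (csuc a) ≡ 0 → CsucView a

  csuc-view : ∀ a → CsucView a
  csuc-view a with m≤n⇒m<n∨m≡n (toℕ<n a)
  ... | inj₁ 1+a<m = interior (toℕ-[]-< 1+a<m)
  ... | inj₂ 1+a≡m = wrap (suc-injective 1+a≡m)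
                          (trans (toℕ-[] (suc (toℕ a))) (trans (cong (_% m) 1+a≡m) (n%n≡0 m)))

  sub[k+y]y≡[k] : ∀ k y → sub m ([ k + toℕ y ] m) y ≡ [ k ] m
  sub[k+y]y≡[k] k y = begin
    [ toℕ ([ k + b ] m) + d ] m ≡⟨ cong (λ r → [ r + d ] m) (toℕ-[] (k + b)) ⟩
    [ (k + b) % m + d ] m       ≡⟨ cong (λ r → [ r ] m) (+-comm ((k + b) % m) d) ⟩
    [ d + (k + b) % m ] m       ≡⟨ [k+l%m]≡[k+l] d (k + b) ⟩
    [ d + (k + b) ] m           ≡⟨ cong (λ r → [ r ] m) (shuffle d k b) ⟩
    [ (d + b) + k ] m           ≡⟨ cong (λ r → [ r + k ] m) (m∸n+n≡m (<⇒≤ (toℕ<n y))) ⟩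
    [ m + k ] m                 ≡⟨ [m+k]≡[k] k ⟩
    [ k ] m                     ∎
    where
    open ≡-Reasoning
    b d : ℕ
    b = toℕ y
    d = m ∸ toℕ y
    shuffle : ∀ p q r → p + (q + r) ≡ (p + r) + q
    shuffle p q r = trans (cong (p +_) (+-comm q r)) (sym (+-assoc p r q))

  [y+[x-y]]≡x : ∀ x y → [ toℕ y + toℕ (sub m x y) ] m ≡ x
  [y+[x-y]]≡x x y = begin
    [ b + toℕ (sub m x y) ] m   ≡⟨ cong (λ r → [ b + r ] m) (toℕ-[] (toℕ x + d)) ⟩
    [ b + (toℕ x + d) % m ] m   ≡⟨ [k+l%m]≡[k+l] b (toℕ x + d) ⟩
    [ b + (toℕ x + d) ] m       ≡⟨ cong (λ r → [ r ] m) (shuffle b (toℕ x) d) ⟩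
    [ (d + b) + toℕ x ] m       ≡⟨ cong (λ r → [ r + toℕ x ] m) (m∸n+n≡m (<⇒≤ (toℕ<n y))) ⟩
    [ m + toℕ x ] m             ≡⟨ [m+k]≡[k] (toℕ x) ⟩
    [ toℕ x ] m                 ≡⟨ []-toℕ x ⟩
    x                           ∎
    where
    open ≡-Reasoning
    b d : ℕ
    b = toℕ y
    d = m ∸ toℕ y
    shuffle : ∀ p q r → p + (q + r) ≡ (r + p) + q
    shuffle p q r = trans (sym (+-assoc p q r)) (trans (+-comm (p + q) r) (sym (+-assoc r p q)))

  sub≡[k]⇒≡[k+y] : ∀ {x y} k → sub m x y ≡ [ k ] m → x ≡ [ k + toℕ y ] m
  sub≡[k]⇒≡[k+y] {x} {y} k eq = begin
    x                             ≡⟨ [y+[x-y]]≡x x y ⟨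
    [ toℕ y + toℕ (sub m x y) ] m ≡⟨ cong (λ r → [ toℕ y + toℕ r ] m) eq ⟩
    [ toℕ y + toℕ ([ k ] m) ] m   ≡⟨ cong (λ r → [ toℕ y + r ] m) (toℕ-[] k) ⟩
    [ toℕ y + k % m ] m           ≡⟨ [k+l%m]≡[k+l] (toℕ y) k ⟩
    [ toℕ y + k ] m               ≡⟨ cong (λ r → [ r ] m) (+-comm (toℕ y) k) ⟩
    [ k + toℕ y ] m               ∎
    where open ≡-Reasoning

  sub-csuc-self : ∀ a → sub m (csuc a) a ≡ [ 1 ] m
  sub-csuc-self = sub[k+y]y≡[k] 1

  sub-self-csuc : ∀ a → sub m a (csuc a) ≡ [ n ] m
  sub-self-csuc a = subst (λ x → sub m x (csuc a) ≡ [ n ] m) (cpred-csuc a) (sub[k+y]y≡[k] n (csuc a))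

  sub≡1⇒≡csuc : ∀ {x y} → sub m x y ≡ [ 1 ] m → x ≡ csuc y
  sub≡1⇒≡csuc = sub≡[k]⇒≡[k+y] 1

  sub≡-1⇒csuc≡ : ∀ {x y} → sub m x y ≡ [ n ] m → y ≡ csuc x
  sub≡-1⇒csuc≡ {x} {y} eq = trans (sym (csuc-cpred y)) (cong csuc (sym (sub≡[k]⇒≡[k+y] n eq)))

  csuc-csuc≢ : 1 < n → ∀ a → csuc (csuc a) ≢ a
  csuc-csuc≢ 1<n a eq = <⇒≢ 1<n (begin
    1                                    ≡⟨ toℕ-[]-< (m<n⇒m<1+n 1<n) ⟨
    toℕ ([ 1 ] m)                        ≡⟨ cong toℕ (sub-csuc-self (csuc a)) ⟨
    toℕ (sub m (csuc (csuc a)) (csuc a)) ≡⟨ cong (λ x → toℕ (sub m x (csuc a))) eq ⟩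
    toℕ (sub m a (csuc a))               ≡⟨ cong toℕ (sub-self-csuc a) ⟩
    toℕ ([ n ] m)                        ≡⟨ toℕ-[]-< (n<1+n n) ⟩
    n                                    ∎)
    where open ≡-Reasoning

-- ℤ_8 and the shifts ±1, 4

infixl 6 _⊕_ _⊖_

_⊕_ : Fin 8 → Fin 8 → Fin 8
x ⊕ y = [ toℕ x + toℕ y ] 8

_⊖_ : Fin 8 → Fin 8 → Fin 8
_⊖_ = sub 8

⊕-swapʳ : ∀ x y z → x ⊕ y ⊕ z ≡ x ⊕ z ⊕ y
⊕-swapʳ = from-yes (all? λ x → all? λ y → all? λ z → (x ⊕ y ⊕ z) ≟ᶠ (x ⊕ z ⊕ y))

⊕-cancelˡ : ∀ x y z → x ⊕ y ≡ x ⊕ z → y ≡ z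
⊕-cancelˡ = from-yes (all? λ x → all? λ y → all? λ z → ((x ⊕ y) ≟ᶠ (x ⊕ z)) →-dec (y ≟ᶠ z))

[x⊕y]⊖x≡y : ∀ x y → (x ⊕ y) ⊖ x ≡ y
[x⊕y]⊖x≡y = from-yes (all? λ x → all? λ y → ((x ⊕ y) ⊖ x) ≟ᶠ y)

x⊕[y⊖x]≡y : ∀ x y → x ⊕ (y ⊖ x) ≡ y
x⊕[y⊖x]≡y = from-yes (all? λ x → all? λ y → (x ⊕ (y ⊖ x)) ≟ᶠ y)

x⊖[x⊕y]≡0⊖y : ∀ x y → x ⊖ (x ⊕ y) ≡ # 0 ⊖ y
x⊖[x⊕y]≡0⊖y = from-yes (all? λ x → all? λ y → (x ⊖ (x ⊕ y)) ≟ᶠ (# 0 ⊖ y))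

x⊖y≡z⇒y≡x⊕[0⊖z] : ∀ x y z → x ⊖ y ≡ z → y ≡ x ⊕ (# 0 ⊖ z)
x⊖y≡z⇒y≡x⊕[0⊖z] = from-yes (all? λ x → all? λ y → all? λ z →
  ((x ⊖ y) ≟ᶠ z) →-dec (y ≟ᶠ (x ⊕ (# 0 ⊖ z))))

x⊕4⊕4≡x : ∀ x → x ⊕ # 4 ⊕ # 4 ≡ x
x⊕4⊕4≡x = from-yes (all? λ x → (x ⊕ # 4 ⊕ # 4) ≟ᶠ x)

data Shift : Set where
  inc dec opp : Shift

⟦_⟧ : Shift → Fin 8
⟦ inc ⟧ = # 1
⟦ dec ⟧ = # 7
⟦ opp ⟧ = # 4

negate : Shift → Shift
negate inc = dec
negate dec = inc
negate opp = opp

0⊖⟦s⟧≡⟦negate-s⟧ : ∀ s → # 0 ⊖ ⟦ s ⟧ ≡ ⟦ negate s ⟧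
0⊖⟦s⟧≡⟦negate-s⟧ inc = refl
0⊖⟦s⟧≡⟦negate-s⟧ dec = refl
0⊖⟦s⟧≡⟦negate-s⟧ opp = refl

⟦⟧-injective : ∀ {s s'} → ⟦ s ⟧ ≡ ⟦ s' ⟧ → s ≡ s'
⟦⟧-injective {inc} {inc} _ = refl
⟦⟧-injective {dec} {dec} _ = refl
⟦⟧-injective {opp} {opp} _ = refl
⟦⟧-injective {inc} {dec} ()
⟦⟧-injective {inc} {opp} ()
⟦⟧-injective {dec} {inc} ()
⟦⟧-injective {dec} {opp} ()
⟦⟧-injective {opp} {inc} ()
⟦⟧-injective {opp} {dec} ()

IsShift : Fin 8 → Set
IsShift d = d ≡ [ 1 ] 8 ⊎ d ≡ [ 7 ] 8 ⊎ d ≡ [ 4 ] 8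

isShift : ∀ s → IsShift ⟦ s ⟧
isShift inc = inj₁ refl
isShift dec = inj₂ (inj₁ refl)
isShift opp = inj₂ (inj₂ refl)

toShift : ∀ {d} → IsShift d → ∃ λ s → d ≡ ⟦ s ⟧
toShift (inj₁ refl)        = inc , refl
toShift (inj₂ (inj₁ refl)) = dec , refl
toShift (inj₂ (inj₂ refl)) = opp , refl

anyShift? : {P : Shift → Set} → (∀ s → Dec (P s)) → Dec (∃ P)
anyShift? P? with P? inc | P? dec | P? opp
... | yes p | _     | _     = yes (inc , p)
... | no _  | yes p | _     = yes (dec , p)
... | no _  | no _  | yes p = yes (opp , p)
... | no ¬p | no ¬q | no ¬r = no λ { (inc , p) → ¬p p ; (dec , p) → ¬q p ; (opp , p) → ¬r p }

-- Decompositions from edge colourings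

WalkEdge : ∀ {V : Set} {k} → (Fin k → V) → V → V → Set
WalkEdge w x y = ∃[ i ] ((x ≡ w i × y ≡ w (csuc i)) ⊎ (y ≡ w i × x ≡ w (csuc i)))

CycleEdge : ∀ {V : Set} {t k} → (Fin t → Fin k → V) → V → V → Set
CycleEdge cyc x y = ∃[ j ] WalkEdge (cyc j) x y

walkEdge-sym : ∀ {V : Set} {k} {w : Fin k → V} {x y} → WalkEdge w x y → WalkEdge w y x
walkEdge-sym (i , inj₁ p) = i , inj₂ p
walkEdge-sym (i , inj₂ p) = i , inj₁ p

cycleEdge-sym : ∀ {V : Set} {t k} {cyc : Fin t → Fin k → V} {x y} →
                CycleEdge cyc x y → CycleEdge cyc y x
cycleEdge-sym (j , e) = j , walkEdge-sym e

walkEdge-resp : ∀ {V : Set} {k} {w w' : Fin k → V} {x x' y y'} → (∀ i → w i ≡ w' i) →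
                x ≡ x' → y ≡ y' → WalkEdge w x y → WalkEdge w' x' y'
walkEdge-resp w≗w' refl refl (i , inj₁ (refl , refl)) = i , inj₁ (w≗w' i , w≗w' (csuc i))
walkEdge-resp w≗w' refl refl (i , inj₂ (refl , refl)) = i , inj₂ (w≗w' i , w≗w' (csuc i))

walkEdge-map : ∀ {U V : Set} {k} (f : U → V) {w : Fin k → U} {x y} →
               WalkEdge w x y → WalkEdge (λ i → f (w i)) (f x) (f y)
walkEdge-map f (i , inj₁ (refl , refl)) = i , inj₁ (refl , refl)
walkEdge-map f (i , inj₂ (refl , refl)) = i , inj₂ (refl , refl)

data EightColour : Set where
  red blue : EightColour

data Colour : Set where
  eight : EightColour → Colour
  green : Colour

module ColouredDecomposition
  {V : Set} {Adj : V → V → Set}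
  (Coloured : Colour → V → V → Set)
  (coloured-sym : ∀ {c x y} → Coloured c x y → Coloured c y x)
  (coloured⇒adj : ∀ {c x y} → Coloured c x y → Adj x y)
  (adj⇒coloured : ∀ {x y} → Adj x y → ∃ λ c → Coloured c x y)
  (colour-unique : ∀ {c c' x y} → Coloured c x y → Coloured c' x y → c ≡ c')
  where

  record ColouredCycles (c : Colour) (k : ℕ) : Set where
    field
      count       : ℕ
      cycle       : Fin count → Fin k → V
      bijective   : Bijective _≡_ _≡_ (λ (p : Fin count × Fin k) → cycle (proj₁ p) (proj₂ p))
      consecutive : ∀ j i → Coloured c (cycle j i) (cycle j (csuc i))
      complete    : ∀ {x y} → Coloured c x y → CycleEdge cycle x y

  factor : ∀ {c k} → ColouredCycles c k → CFactor Adj k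
  factor C = record
    { t = count ; cyc = cycle ; cover = bijective ; edges = λ j i → coloured⇒adj (consecutive j i) }
    where open ColouredCycles C

  edge⇒coloured : ∀ {c k} (C : ColouredCycles c k) {x y} → Edge (factor C) x y → Coloured c x y
  edge⇒coloured C (j , i , inj₁ (refl , refl)) = ColouredCycles.consecutive C j i
  edge⇒coloured C (j , i , inj₂ (refl , refl)) = coloured-sym (ColouredCycles.consecutive C j i)

  decomposition : ∀ {k l} → ColouredCycles (eight red) k → ColouredCycles (eight blue) k →
                  ColouredCycles green l → Decomp Adj k l
  decomposition R B G = record
    { F₁ = factor R ; F₂ = factor B ; F₃ = factor G
    ; covered = covered
    ; disj₁₂  = λ { _ _ (e , e') → red≢blue   (colour-unique (edge⇒coloured R e) (edge⇒coloured B e')) }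
    ; disj₁₃  = λ { _ _ (e , e') → red≢green  (colour-unique (edge⇒coloured R e) (edge⇒coloured G e')) }
    ; disj₂₃  = λ { _ _ (e , e') → blue≢green (colour-unique (edge⇒coloured B e) (edge⇒coloured G e')) }
    }
    where
    covered : ∀ x y → Adj x y → Edge (factor R) x y ⊎ Edge (factor B) x y ⊎ Edge (factor G) x y
    covered x y xy with adj⇒coloured xy
    ... | eight red  , p = inj₁ (ColouredCycles.complete R p)
    ... | eight blue , p = inj₂ (inj₁ (ColouredCycles.complete B p))
    ... | green      , p = inj₂ (inj₂ (ColouredCycles.complete G p))
    red≢blue : eight red ≢ eight blue
    red≢blue ()
    red≢green : eight red ≢ green
    red≢green ()
    blue≢green : eight blue ≢ green
    blue≢green ()

-- The Cayley graph as arcs between consecutive columns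

module CayleyArcs (n : ℕ) where
  open CyclicGroup n

  V : Set
  V = Γ m

  fwd : Shift → V → V
  fwd s (a , c) = csuc a , c ⊕ ⟦ s ⟧

  -- S writes −1 ∈ ℤ_m as [ m ∸ 1 ] m, which computes to [ n ] m.
  adj-fwd : ∀ s x → CayAdj m x (fwd s x)
  adj-fwd s (a , c) =
    inj₂ (sub-self-csuc a) ,
    subst IsShift (sym (trans (x⊖[x⊕y]≡0⊖y c ⟦ s ⟧) (0⊖⟦s⟧≡⟦negate-s⟧ s))) (isShift (negate s))

  fwd-adj : ∀ s x → CayAdj m (fwd s x) x
  fwd-adj s (a , c) = inj₁ (sub-csuc-self a) , subst IsShift (sym ([x⊕y]⊖x≡y c ⟦ s ⟧)) (isShift s)

  adj⇒fwd : ∀ {x y} → CayAdj m x y → ∃ λ s → y ≡ fwd s x ⊎ x ≡ fwd s y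
  adj⇒fwd {a , c} {b , e} (inj₁ a≡b+1 , d) with toShift d
  ... | s , c⊖e≡s =
    s , inj₂ (cong₂ _,_ (sub≡1⇒≡csuc a≡b+1) (trans (sym (x⊕[y⊖x]≡y e c)) (cong (e ⊕_) c⊖e≡s)))
  adj⇒fwd {a , c} {b , e} (inj₂ b≡a+1 , d) with toShift d
  ... | s , c⊖e≡s =
    negate s , inj₁ (cong₂ _,_ (sub≡-1⇒csuc≡ b≡a+1)
                       (trans (x⊖y≡z⇒y≡x⊕[0⊖z] c e _ c⊖e≡s) (cong (c ⊕_) (0⊖⟦s⟧≡⟦negate-s⟧ s))))

  fwd-injectiveˡ : ∀ {s s'} x → fwd s x ≡ fwd s' x → s ≡ s'
  fwd-injectiveˡ (a , c) eq = ⟦⟧-injective (⊕-cancelˡ c _ _ (cong proj₂ eq))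

  fwd-fwd≢ : 1 < n → ∀ s s' x → fwd s' (fwd s x) ≢ x
  fwd-fwd≢ 1<n s s' (a , c) eq = csuc-csuc≢ 1<n a (cong proj₁ eq)

  module Colouring (colour : Shift → V → Colour) where

    Arc : Colour → V → V → Set
    Arc c x y = ∃ λ s → y ≡ fwd s x × colour s x ≡ c

    Coloured : Colour → V → V → Set
    Coloured c x y = Arc c x y ⊎ Arc c y x

    coloured-sym : ∀ {c x y} → Coloured c x y → Coloured c y x
    coloured-sym (inj₁ a) = inj₂ a
    coloured-sym (inj₂ a) = inj₁ a

    coloured⇒adj : ∀ {c x y} → Coloured c x y → CayAdj m x y
    coloured⇒adj {x = x} (inj₁ (s , refl , _)) = adj-fwd s x
    coloured⇒adj {y = y} (inj₂ (s , refl , _)) = fwd-adj s y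

    adj⇒coloured : ∀ {x y} → CayAdj m x y → ∃ λ c → Coloured c x y
    adj⇒coloured {x} {y} xy with adj⇒fwd {x} {y} xy
    ... | s , inj₁ refl = colour s x , inj₁ (s , refl , refl)
    ... | s , inj₂ refl = colour s y , inj₂ (s , refl , refl)

    colour-unique : 1 < n → ∀ {c c' x y} → Coloured c x y → Coloured c' x y → c ≡ c'
    colour-unique _ {x = x} (inj₁ (s , refl , p)) (inj₁ (s' , q , p')) =
      trans (sym p) (trans (cong (λ s → colour s x) (fwd-injectiveˡ x q)) p')
    colour-unique _ {y = y} (inj₂ (s , refl , p)) (inj₂ (s' , q , p')) =
      trans (sym p) (trans (cong (λ s → colour s y) (fwd-injectiveˡ y q)) p')
    colour-unique 1<n (inj₁ (s , refl , _)) (inj₂ (s' , q , _)) = ⊥-elim (fwd-fwd≢ 1<n s s' _ (sym q))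
    colour-unique 1<n (inj₂ (s , refl , _)) (inj₁ (s' , q , _)) = ⊥-elim (fwd-fwd≢ 1<n s s' _ (sym q))

-- The colouring and its local model

parityColour : Fin 8 → EightColour
parityColour c with toℕ c % 2
... | 0 = red
... | _ = blue

swap : EightColour → EightColour
swap red  = blue
swap blue = red

colourAt : ℕ → Fin 8 → Shift → Colour
colourAt 0 c inc = green
colourAt 0 c dec = eight (parityColour c)
colourAt 0 c opp = eight (parityColour c)
colourAt 1 c inc = green
colourAt 1 c dec = eight blue
colourAt 1 c opp = eight red
colourAt 2 c inc = green
colourAt 2 c dec = eight blue
colourAt 2 c opp = eight red
colourAt 3 c inc = green
colourAt 3 c dec = eight (parityColour c)
colourAt 3 c opp = eight (swap (parityColour c))
colourAt (suc (suc (suc (suc _)))) c inc = eight (parityColour c)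
colourAt (suc (suc (suc (suc _)))) c dec = eight (parityColour c)
colourAt (suc (suc (suc (suc _)))) c opp = green

colourAt-≥4 : ∀ A c s → 4 ≤ A → colourAt A c s ≡ colourAt 4 c s
colourAt-≥4 (suc (suc (suc (suc _)))) c inc _ = refl
colourAt-≥4 (suc (suc (suc (suc _)))) c dec _ = refl
colourAt-≥4 (suc (suc (suc (suc _)))) c opp _ = refl
colourAt-≥4 0 _ _ ()
colourAt-≥4 1 _ _ (s≤s ())
colourAt-≥4 2 _ _ (s≤s (s≤s ()))
colourAt-≥4 3 _ _ (s≤s (s≤s (s≤s ())))

_≟ᵉ_ : (e e' : EightColour) → Dec (e ≡ e')
red  ≟ᵉ red  = yes refl
red  ≟ᵉ blue = no λ ()
blue ≟ᵉ red  = no λ ()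
blue ≟ᵉ blue = yes refl

_≟ᶜ_ : (c c' : Colour) → Dec (c ≡ c')
eight e ≟ᶜ eight e' = map′ (cong eight) (λ { refl → refl }) (e ≟ᵉ e')
eight _ ≟ᶜ green    = no λ ()
green   ≟ᶜ eight _  = no λ ()
green   ≟ᶜ green    = yes refl

allEight? : {P : EightColour → Set} → (∀ e → Dec (P e)) → Dec (∀ e → P e)
allEight? P? with P? red | P? blue
... | yes p | yes q = yes λ { red → p ; blue → q }
... | no ¬p | _     = no λ h → ¬p (h red)
... | yes _ | no ¬q = no λ h → ¬q (h blue)

-- A vertex (A , c) of the local model: a column A, not reduced modulo m, and a label c.
Local : Set
Local = ℕ × Fin 8

_≟ˡ_ : (u v : Local) → Dec (u ≡ v)
_≟ˡ_ = ≡-dec _≟ⁿ_ _≟ᶠ_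

LocalArc : Colour → Local → Local → Set
LocalArc col (A , c) (B , d) = ∃ λ s → B ≡ suc A × d ≡ c ⊕ ⟦ s ⟧ × colourAt A c s ≡ col

LocalColoured : Colour → Local → Local → Set
LocalColoured col u v = LocalArc col u v ⊎ LocalArc col v u

localArc? : ∀ col u v → Dec (LocalArc col u v)
localArc? col (A , c) (B , d) =
  anyShift? λ s → (B ≟ⁿ suc A) ×-dec (d ≟ᶠ c ⊕ ⟦ s ⟧) ×-dec (colourAt A c s ≟ᶜ col)

localColoured? : ∀ col u v → Dec (LocalColoured col u v)
localColoured? col u v = localArc? col u v ⊎-dec localArc? col v u

walkEdge? : ∀ {k} (w : Fin k → Local) u v → Dec (WalkEdge w u v)
walkEdge? w u v = any? λ i →
  ((u ≟ˡ w i) ×-dec (v ≟ˡ w (csuc i))) ⊎-dec ((v ≟ˡ w i) ×-dec (u ≟ˡ w (csuc i)))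

height : Fin 8 → ℕ
height i = lookup (0 ∷ 1 ∷ 2 ∷ 3 ∷ 4 ∷ 3 ∷ 2 ∷ 1 ∷ []) i

height≤4 : ∀ i → height i ≤ 4
height≤4 = from-yes (all? λ i → height i ≤? 4)

start : EightColour → Fin 8 → Fin 8
start red  i = lookup (# 6 ∷ # 2 ∷ # 6 ∷ # 2 ∷ # 1 ∷ # 5 ∷ # 1 ∷ # 5 ∷ []) i
start blue i = lookup (# 3 ∷ # 2 ∷ # 1 ∷ # 0 ∷ # 4 ∷ # 5 ∷ # 6 ∷ # 7 ∷ []) i

segmentWalk : EightColour → Fin 4 → Fin 8 → Local
segmentWalk e j i = height i , start e i ⊕ [ 2 * toℕ j ] 8

lane : EightColour → Fin 8 → Fin 8
lane red  i = i
lane blue i = # 1 ⊖ i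

-- Placed on columns j and j + 1 (see bandColumn below), this is the band starting at column j.
bandWalk : EightColour → Fin 8 → Local
bandWalk e i = 4 + toℕ i % 2 , lane e i

bandHeight : ∀ e i → proj₁ (bandWalk e i) ≡ 4 ⊎ proj₁ (bandWalk e i) ≡ 5
bandHeight e i with toℕ i % 2 | m%n<n (toℕ i) 2
... | 0           | _ = inj₁ refl
... | 1           | _ = inj₂ refl
... | suc (suc _) | s≤s (s≤s ())

bandArc-source : ∀ {col} e i i' → LocalArc col (bandWalk e i) (bandWalk e i') →
                 proj₁ (bandWalk e i) ≡ 4
bandArc-source e i i' (_ , up , _) with bandHeight e i | bandHeight e i'
... | inj₁ h | _      = h
... | inj₂ h | inj₁ h' = contradiction (trans (sym h') (trans up (cong suc h))) λ ()
... | inj₂ h | inj₂ h' = contradiction (trans (sym h') (trans up (cong suc h))) λ ()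

segment-consecutive : ∀ e j i →
  LocalColoured (eight e) (segmentWalk e j i) (segmentWalk e j (csuc i))
segment-consecutive = from-yes (allEight? λ e → all? λ j → all? λ i →
  localColoured? (eight e) (segmentWalk e j i) (segmentWalk e j (csuc i)))

band-consecutive : ∀ e i → LocalColoured (eight e) (bandWalk e i) (bandWalk e (csuc i))
band-consecutive = from-yes (allEight? λ e → all? λ i →
  localColoured? (eight e) (bandWalk e i) (bandWalk e (csuc i)))

segment-complete : ∀ e (A : Fin 4) c d → LocalArc (eight e) (toℕ A , c) (suc (toℕ A) , d) →
                   CycleEdge (segmentWalk e) (toℕ A , c) (suc (toℕ A) , d)
segment-complete = from-yes (allEight? λ e → all? λ (A : Fin 4) → all? λ c → all? λ d →
  localArc? (eight e) (toℕ A , c) (suc (toℕ A) , d) →-dec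
  any? λ j → walkEdge? (segmentWalk e j) (toℕ A , c) (suc (toℕ A) , d))

band-complete : ∀ e c d → LocalArc (eight e) (4 , c) (5 , d) →
                WalkEdge (bandWalk e) (4 , c) (5 , d)
band-complete = from-yes (allEight? λ e → all? λ c → all? λ d →
  localArc? (eight e) (4 , c) (5 , d) →-dec walkEdge? (bandWalk e) (4 , c) (5 , d))

data Position : Set where
  segment : Fin 4 → Fin 8 → Position
  band    : Fin 8 → Position
  band⁻   : Fin 8 → Position

_≟ᵖ_ : (p q : Position) → Dec (p ≡ q)
segment j i ≟ᵖ segment j' i' =
  map′ (λ { (refl , refl) → refl }) (λ { refl → refl , refl }) ((j ≟ᶠ j') ×-dec (i ≟ᶠ i'))
band i      ≟ᵖ band i'       = map′ (cong band) (λ { refl → refl }) (i ≟ᶠ i')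
band⁻ i     ≟ᵖ band⁻ i'      = map′ (cong band⁻) (λ { refl → refl }) (i ≟ᶠ i')
segment _ _ ≟ᵖ band _        = no λ ()
segment _ _ ≟ᵖ band⁻ _       = no λ ()
band _      ≟ᵖ segment _ _   = no λ ()
band _      ≟ᵖ band⁻ _       = no λ ()
band⁻ _     ≟ᵖ segment _ _   = no λ ()
band⁻ _     ≟ᵖ band _        = no λ ()

anyPosition? : {P : Position → Set} → (∀ p → Dec (P p)) → Dec (∃ P)
anyPosition? P?
  with any? (λ j → any? λ i → P? (segment j i)) | any? (λ i → P? (band i)) | any? (λ i → P? (band⁻ i))
... | yes (j , i , p) | _           | _           = yes (segment j i , p)
... | no _            | yes (i , p) | _           = yes (band i , p)
... | no _            | no _        | yes (i , p) = yes (band⁻ i , p)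
... | no ¬s           | no ¬b       | no ¬b⁻      =
  no λ { (segment j i , p) → ¬s (j , i , p) ; (band i , p) → ¬b (i , p) ; (band⁻ i , p) → ¬b⁻ (i , p) }

allPosition? : {P : Position → Set} → (∀ p → Dec (P p)) → Dec (∀ p → P p)
allPosition? P?
  with all? (λ j → all? λ i → P? (segment j i)) | all? (λ i → P? (band i)) | all? (λ i → P? (band⁻ i))
... | yes s | yes b | yes b⁻ = yes λ { (segment j i) → s j i ; (band i) → b i ; (band⁻ i) → b⁻ i }
... | no ¬s | _     | _      = no λ h → ¬s λ j i → h (segment j i)
... | yes _ | no ¬b | _      = no λ h → ¬b λ i → h (band i)
... | yes _ | yes _ | no ¬b⁻ = no λ h → ¬b⁻ λ i → h (band⁻ i)

-- Where the vertex with label c in column A lies: on a segment, on the band starting at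
-- column A, or on the band starting at the previous column; column 0 receives the band
-- starting at column m − 1.
Locates : EightColour → ℕ → Fin 8 → Position → Set
Locates e A c (segment j i) = segmentWalk e j i ≡ (A , c)
Locates e A c (band i)      = bandWalk e i ≡ (4 , c) × 4 ≤ A
Locates e A c (band⁻ i)     = bandWalk e i ≡ (5 , c) × (A ≡ 0 ⊎ 5 ≤ A)

locates? : ∀ e A c p → Dec (Locates e A c p)
locates? e A c (segment j i) = segmentWalk e j i ≟ˡ (A , c)
locates? e A c (band i)      = (bandWalk e i ≟ˡ (4 , c)) ×-dec (4 ≤? A)
locates? e A c (band⁻ i)     = (bandWalk e i ≟ˡ (5 , c)) ×-dec ((A ≟ⁿ 0) ⊎-dec (5 ≤? A))

locatable : ∀ e (A : Fin 6) c → ∃ (Locates e (toℕ A) c)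
locatable = from-yes (allEight? λ e → all? λ (A : Fin 6) → all? λ c →
  anyPosition? (locates? e (toℕ A) c))

-- The hypothesis on p precedes the quantifier over q, so the check skips q for every p that
-- does not locate the vertex.
location-unique : ∀ e (A : Fin 6) c p → Locates e (toℕ A) c p → ∀ q → Locates e (toℕ A) c q → p ≡ q
location-unique = from-yes (allEight? λ e → all? λ (A : Fin 6) → all? λ c → allPosition? λ p →
  locates? e (toℕ A) c p →-dec allPosition? λ q → locates? e (toℕ A) c q →-dec (p ≟ᵖ q))

locates-≥5 : ∀ e k c p → Locates e (5 + k) c p → Locates e 5 c p
locates-≥5 e k c (segment j i) eq = contradiction (cong proj₁ eq) height≢
  where
  height≢ : height i ≢ 5 + k
  height≢ h = <⇒≱ (s≤s (height≤4 i)) (subst (5 ≤_) (sym h) (m≤m+n 5 k))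
locates-≥5 e k c (band i)  (eq , _) = eq , s≤s (s≤s (s≤s (s≤s z≤n)))
locates-≥5 e k c (band⁻ i) (eq , _) = eq , inj₂ ≤-refl

locates-5 : ∀ e k c p → Locates e 5 c p → Locates e (5 + k) c p
locates-5 e k c (segment j i) eq = contradiction (cong proj₁ eq) height≢
  where
  height≢ : height i ≢ 5
  height≢ h = <⇒≱ (s≤s (height≤4 i)) (≤-reflexive (sym h))
locates-5 e k c (band i)  (eq , _) = eq , ≤-trans (n≤1+n 4) (m≤m+n 5 k)
locates-5 e k c (band⁻ i) (eq , _) = eq , inj₂ (m≤m+n 5 k)

locate : ∀ e A c → ∃ (Locates e A c)
locate e 0 c = locatable e (# 0) c
locate e 1 c = locatable e (# 1) c
locate e 2 c = locatable e (# 2) c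
locate e 3 c = locatable e (# 3) c
locate e 4 c = locatable e (# 4) c
locate e (suc (suc (suc (suc (suc k))))) c = lift (locatable e (# 5) c)
  where
  -- Matching on the pair, instead of projecting, keeps the type checker from normalising
  -- the enumeration behind locatable.
  lift : ∃ (Locates e 5 c) → ∃ (Locates e (5 + k) c)
  lift (p , loc) = p , locates-5 e k c p loc

locate-unique : ∀ e A c {p q} → Locates e A c p → Locates e A c q → p ≡ q
locate-unique e 0 c {p} {q} lp lq = location-unique e (# 0) c p lp q lq
locate-unique e 1 c {p} {q} lp lq = location-unique e (# 1) c p lp q lq
locate-unique e 2 c {p} {q} lp lq = location-unique e (# 2) c p lp q lq
locate-unique e 3 c {p} {q} lp lq = location-unique e (# 3) c p lp q lq
locate-unique e 4 c {p} {q} lp lq = location-unique e (# 4) c p lp q lq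
locate-unique e (suc (suc (suc (suc (suc k))))) c {p} {q} lp lq =
  location-unique e (# 5) c p (locates-≥5 e k c p lp) q (locates-≥5 e k c q lq)

greenShift : ℕ → Shift
greenShift 0 = inc
greenShift 1 = inc
greenShift 2 = inc
greenShift 3 = inc
greenShift (suc (suc (suc (suc _)))) = opp

colourAt-greenShift : ∀ A c → colourAt A c (greenShift A) ≡ green
colourAt-greenShift 0 c = refl
colourAt-greenShift 1 c = refl
colourAt-greenShift 2 c = refl
colourAt-greenShift 3 c = refl
colourAt-greenShift (suc (suc (suc (suc _)))) c = refl

green⇒greenShift : ∀ A c s → colourAt A c s ≡ green → s ≡ greenShift A
green⇒greenShift 0 c inc _ = refl
green⇒greenShift 1 c inc _ = refl
green⇒greenShift 2 c inc _ = refl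
green⇒greenShift 3 c inc _ = refl
green⇒greenShift (suc (suc (suc (suc _)))) c opp _ = refl
green⇒greenShift 0 c dec ()
green⇒greenShift 0 c opp ()
green⇒greenShift 1 c dec ()
green⇒greenShift 1 c opp ()
green⇒greenShift 2 c dec ()
green⇒greenShift 2 c opp ()
green⇒greenShift 3 c dec ()
green⇒greenShift 3 c opp ()
green⇒greenShift (suc (suc (suc (suc _)))) c inc ()
green⇒greenShift (suc (suc (suc (suc _)))) c dec ()

offset : ℕ → Fin 8
offset zero    = # 0
offset (suc A) = offset A ⊕ ⟦ greenShift A ⟧

offset-closes : ∀ k → (5 + k) % 2 ≡ 1 → offset (5 + k) ≡ offset 0
offset-closes 0 _ = refl
offset-closes 1 ()
offset-closes (suc (suc k)) odd = trans (x⊕4⊕4≡x (offset (5 + k))) (offset-closes k odd′)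
  where
  odd′ : (5 + k) % 2 ≡ 1
  odd′ = trans (sym ([m+n]%n≡m%n (5 + k) 2)) (trans (cong (_% 2) (+-comm (5 + k) 2)) odd)

-- The three factors

module Factors (n : ℕ) (4≤n : 4 ≤ n) (closes : offset (suc n) ≡ offset 0) where
  open CyclicGroup n
  open CayleyArcs n

  colour : Shift → V → Colour
  colour s (a , c) = colourAt (toℕ a) c s

  open Colouring colour

  1<n : 1 < n
  1<n = ≤-trans (s≤s (s≤s z≤n)) 4≤n

  open ColouredDecomposition Coloured coloured-sym coloured⇒adj adj⇒coloured (colour-unique 1<n)

  greenCycle : Fin 8 → Fin m → V
  greenCycle j a = a , offset (toℕ a) ⊕ j

  offset-csuc : ∀ a → offset (toℕ (csuc a)) ≡ offset (toℕ a) ⊕ ⟦ greenShift (toℕ a) ⟧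
  offset-csuc a with csuc-view a
  ... | interior eq = cong offset eq
  ... | wrap a≡n eq = begin
    offset (toℕ (csuc a)) ≡⟨ cong offset eq ⟩
    offset 0              ≡⟨ closes ⟨
    offset (suc n)        ≡⟨ cong (λ A → offset (suc A)) a≡n ⟨
    offset (suc (toℕ a))  ∎
    where open ≡-Reasoning

  greenCycle-csuc : ∀ j a → greenCycle j (csuc a) ≡ fwd (greenShift (toℕ a)) (greenCycle j a)
  greenCycle-csuc j a = cong (csuc a ,_)
    (trans (cong (_⊕ j) (offset-csuc a)) (⊕-swapʳ (offset (toℕ a)) ⟦ greenShift (toℕ a) ⟧ j))

  green-arc : ∀ {x y} → Arc green x y → CycleEdge greenCycle x y
  green-arc {a , c} (s , refl , green≡) with green⇒greenShift (toℕ a) c s green≡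
  ... | refl = j , a , inj₁ (x≡ , sym (trans (greenCycle-csuc j a) (cong (fwd s) (sym x≡))))
    where
    j : Fin 8
    j = c ⊖ offset (toℕ a)
    x≡ : (a , c) ≡ greenCycle j a
    x≡ = cong (a ,_) (sym (x⊕[y⊖x]≡y (offset (toℕ a)) c))

  greenCycles : ColouredCycles green m
  greenCycles = record
    { count       = 8
    ; cycle       = greenCycle
    ; bijective   = inverse⇒bijective _ (λ (a , c) → c ⊖ offset (toℕ a) , a)
                      (λ (a , c) → cong (a ,_) (x⊕[y⊖x]≡y (offset (toℕ a)) c))
                      (λ (j , a) → cong (_, a) ([x⊕y]⊖x≡y (offset (toℕ a)) j))
    ; consecutive = λ j a →
        inj₁ (greenShift (toℕ a) , greenCycle-csuc j a , colourAt-greenShift (toℕ a) _)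
    ; complete    = λ { (inj₁ arc) → green-arc arc ; (inj₂ arc) → cycleEdge-sym (green-arc arc) }
    }

  column : ℕ → Fin m
  column A = [ A ] m

  bandColumn : Fin m → ℕ → Fin m
  bandColumn j 5 = csuc j
  bandColumn j _ = j

  lift : (ℕ → Fin m) → Local → V
  lift ι (A , c) = ι A , c

  Faithful : (ℕ → Fin m) → ℕ → Set
  Faithful ι A = csuc (ι A) ≡ ι (suc A) × (∀ c s → colour s (ι A , c) ≡ colourAt A c s)

  column-faithful : ∀ {A} → A ≤ n → Faithful column A
  column-faithful {A} A≤n =
    cong (λ B → [ suc B ] m) toℕ-column , λ c s → cong (λ B → colourAt B c s) toℕ-column
    where
    toℕ-column : toℕ (column A) ≡ A
    toℕ-column = toℕ-[]-< (s≤s A≤n)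

  bandColumn-faithful : ∀ {j} → 4 ≤ toℕ j → Faithful (bandColumn j) 4
  bandColumn-faithful {j} 4≤j = refl , λ c s → colourAt-≥4 (toℕ j) c s 4≤j

  lift-arc : ∀ ι {col u v} → Faithful ι (proj₁ u) → LocalArc col u v → Arc col (lift ι u) (lift ι v)
  lift-arc ι (csuc≡ , colour≡) (s , refl , refl , col≡) =
    s , cong (_, _) (sym csuc≡) , trans (colour≡ _ s) col≡

  lift-coloured : ∀ ι {col} u v → (LocalArc col u v → Faithful ι (proj₁ u)) →
                  (LocalArc col v u → Faithful ι (proj₁ v)) →
                  LocalColoured col u v → Coloured col (lift ι u) (lift ι v)
  lift-coloured ι u v faithfulᵘ faithfulᵛ (inj₁ arc) = inj₁ (lift-arc ι (faithfulᵘ arc) arc)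
  lift-coloured ι u v faithfulᵘ faithfulᵛ (inj₂ arc) = inj₂ (lift-arc ι (faithfulᵛ arc) arc)

  segment-faithful : ∀ e s i → Faithful column (proj₁ (segmentWalk e s i))
  segment-faithful e s i = column-faithful (≤-trans (height≤4 i) 4≤n)

  band-faithful : ∀ {col j} e i i' → 4 ≤ toℕ j → LocalArc col (bandWalk e i) (bandWalk e i') →
                  Faithful (bandColumn j) (proj₁ (bandWalk e i))
  band-faithful e i i' 4≤j arc =
    subst (Faithful (bandColumn _)) (sym (bandArc-source e i i' arc)) (bandColumn-faithful 4≤j)

  eightWalk : EightColour → Fin m → ℕ → Fin 8 → V
  eightWalk e j 0 i = lift column (segmentWalk e (# 0) i)
  eightWalk e j 1 i = lift column (segmentWalk e (# 1) i)
  eightWalk e j 2 i = lift column (segmentWalk e (# 2) i)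
  eightWalk e j 3 i = lift column (segmentWalk e (# 3) i)
  eightWalk e j (suc (suc (suc (suc _)))) i = lift (bandColumn j) (bandWalk e i)

  eightCycle : EightColour → Fin m → Fin 8 → V
  eightCycle e j = eightWalk e j (toℕ j)

  toℕ-column-toℕ : (s : Fin 4) → toℕ (column (toℕ s)) ≡ toℕ s
  toℕ-column-toℕ s = toℕ-[]-< (≤-trans (toℕ<n s) (≤-trans 4≤n (n≤1+n n)))

  eightCycle-segment : ∀ e s i → eightCycle e (column (toℕ s)) i ≡ lift column (segmentWalk e s i)
  eightCycle-segment e s i =
    trans (cong (λ A → eightWalk e (column (toℕ s)) A i) (toℕ-column-toℕ s)) (walk s)
    where
    walk : ∀ s → eightWalk e (column (toℕ s)) (toℕ s) i ≡ lift column (segmentWalk e s i)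
    walk zero                   = refl
    walk (suc zero)             = refl
    walk (suc (suc zero))       = refl
    walk (suc (suc (suc zero))) = refl

  eightCycle-band : ∀ e j i → 4 ≤ toℕ j → eightCycle e j i ≡ lift (bandColumn j) (bandWalk e i)
  eightCycle-band e j i 4≤j = walk (toℕ j) 4≤j
    where
    walk : ∀ A → 4 ≤ A → eightWalk e j A i ≡ lift (bandColumn j) (bandWalk e i)
    walk (suc (suc (suc (suc _)))) _ = refl
    walk 0 ()
    walk 1 (s≤s ())
    walk 2 (s≤s (s≤s ()))
    walk 3 (s≤s (s≤s (s≤s ())))

  data CycleKind (j : Fin m) : Set where
    segmentCycle : (s : Fin 4) → j ≡ column (toℕ s) → CycleKind j
    bandCycle    : 4 ≤ toℕ j → CycleKind j

  cycleKind : ∀ j → CycleKind j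
  cycleKind j with toℕ j <? 4
  ... | yes j<4 = segmentCycle (fromℕ< j<4)
                    (trans (sym ([]-toℕ j)) (cong column (sym (toℕ-fromℕ< j<4))))
  ... | no j≮4  = bandCycle (≮⇒≥ j≮4)

  eight-consecutive : ∀ e j i → Coloured (eight e) (eightCycle e j i) (eightCycle e j (csuc i))
  eight-consecutive e j i with cycleKind j
  ... | segmentCycle s refl =
    subst₂ (Coloured (eight e)) (sym (eightCycle-segment e s i)) (sym (eightCycle-segment e s (csuc i)))
      (lift-coloured column _ _ (λ _ → segment-faithful e s i) (λ _ → segment-faithful e s (csuc i))
        (segment-consecutive e s i))
  ... | bandCycle 4≤j =
    subst₂ (Coloured (eight e)) (sym (eightCycle-band e j i 4≤j)) (sym (eightCycle-band e j (csuc i) 4≤j))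
      (lift-coloured (bandColumn j) _ _ (band-faithful e i (csuc i) 4≤j) (band-faithful e (csuc i) i 4≤j)
        (band-consecutive e i))

  eight-arc : ∀ e {x y} → Arc (eight e) x y → CycleEdge (eightCycle e) x y
  eight-arc e {a , c} (s , refl , colour≡) with toℕ a <? 4
  ... | yes a<4 = lift-edge (segment-complete e A c (c ⊕ ⟦ s ⟧) (s , refl , refl , local≡))
    where
    A : Fin 4
    A = fromℕ< a<4
    local≡ : colourAt (toℕ A) c s ≡ eight e
    local≡ = trans (cong (λ B → colourAt B c s) (toℕ-fromℕ< a<4)) colour≡
    lift-edge : CycleEdge (segmentWalk e) (toℕ A , c) (suc (toℕ A) , c ⊕ ⟦ s ⟧) →
                CycleEdge (eightCycle e) (a , c) (csuc a , c ⊕ ⟦ s ⟧)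
    lift-edge (t , edge) =
      column (toℕ t) ,
      walkEdge-resp (λ i → sym (eightCycle-segment e t i))
        (cong (_, c) (trans (cong column (toℕ-fromℕ< a<4)) ([]-toℕ a)))
        (cong (λ B → column (suc B) , c ⊕ ⟦ s ⟧) (toℕ-fromℕ< a<4))
        (walkEdge-map (lift column) edge)
  ... | no a≮4 =
    a , walkEdge-resp (λ i → sym (eightCycle-band e a i 4≤a)) refl refl
          (walkEdge-map (lift (bandColumn a)) (band-complete e c (c ⊕ ⟦ s ⟧) (s , refl , refl , local≡)))
    where
    4≤a : 4 ≤ toℕ a
    4≤a = ≮⇒≥ a≮4
    local≡ : colourAt 4 c s ≡ eight e
    local≡ = trans (sym (colourAt-≥4 (toℕ a) c s 4≤a)) colour≡

  index : Fin m → Position → Fin m × Fin 8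
  index a (segment s i) = column (toℕ s) , i
  index a (band i)      = a , i
  index a (band⁻ i)     = cpred a , i

  cpred-≥4 : ∀ a → toℕ a ≡ 0 ⊎ 5 ≤ toℕ a → 4 ≤ toℕ (cpred a)
  cpred-≥4 a h with csuc-view (cpred a)
  ... | wrap cpred≡n _ = subst (4 ≤_) (sym cpred≡n) 4≤n
  ... | interior eq with h | trans (sym (cong toℕ (csuc-cpred a))) eq
  ...   | inj₁ a≡0 | a≡suc = contradiction (trans (sym a≡0) a≡suc) λ ()
  ...   | inj₂ 5≤a | a≡suc = s≤s⁻¹ (subst (5 ≤_) a≡suc 5≤a)

  csuc-0∨≥5 : ∀ j → 4 ≤ toℕ j → toℕ (csuc j) ≡ 0 ⊎ 5 ≤ toℕ (csuc j)
  csuc-0∨≥5 j 4≤j with csuc-view j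
  ... | interior eq = inj₂ (subst (5 ≤_) (sym eq) (s≤s 4≤j))
  ... | wrap _ eq   = inj₁ eq

  located-vertex : ∀ e a c p → Locates e (toℕ a) c p →
                   eightCycle e (proj₁ (index a p)) (proj₂ (index a p)) ≡ (a , c)
  located-vertex e a c (segment s i) eq =
    trans (eightCycle-segment e s i) (trans (cong (lift column) eq) (cong (_, c) ([]-toℕ a)))
  located-vertex e a c (band i) (eq , 4≤a) =
    trans (eightCycle-band e a i 4≤a) (cong (lift (bandColumn a)) eq)
  located-vertex e a c (band⁻ i) (eq , h) =
    trans (eightCycle-band e (cpred a) i (cpred-≥4 a h))
          (trans (cong (lift (bandColumn (cpred a))) eq) (cong (_, c) (csuc-cpred a)))

  cycle-located : ∀ e j i → let (a , c) = eightCycle e j i in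
                  ∃ λ p → Locates e (toℕ a) c p × index a p ≡ (j , i)
  cycle-located e j i with cycleKind j
  ... | segmentCycle s refl rewrite eightCycle-segment e s i =
    segment s i , cong (_, _) (sym (toℕ-[]-< (s≤s (≤-trans (height≤4 i) 4≤n)))) , refl
  ... | bandCycle 4≤j rewrite eightCycle-band e j i 4≤j with bandHeight e i
  ...   | inj₁ h rewrite h = band i , (cong (_, lane e i) h , 4≤j) , refl
  ...   | inj₂ h rewrite h =
    band⁻ i , (cong (_, lane e i) h , csuc-0∨≥5 j 4≤j) , cong (_, i) (cpred-csuc j)

  eightCycle⁻¹ : EightColour → V → Fin m × Fin 8
  eightCycle⁻¹ e (a , c) = index a (proj₁ (locate e (toℕ a) c))

  eightCycle-inverseˡ : ∀ e x → eightCycle e (proj₁ (eightCycle⁻¹ e x)) (proj₂ (eightCycle⁻¹ e x)) ≡ x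
  eightCycle-inverseˡ e (a , c) = located-vertex e a c _ (proj₂ (locate e (toℕ a) c))

  eightCycle-inverseʳ : ∀ e p → eightCycle⁻¹ e (eightCycle e (proj₁ p) (proj₂ p)) ≡ p
  eightCycle-inverseʳ e (j , i) with cycle-located e j i
  ... | p , loc , index≡ =
    trans (cong (index _) (locate-unique e _ _ (proj₂ (locate e _ _)) loc)) index≡

  eightCycles : ∀ e → ColouredCycles (eight e) 8
  eightCycles e = record
    { count       = m
    ; cycle       = eightCycle e
    ; bijective   = inverse⇒bijective _ (eightCycle⁻¹ e) (eightCycle-inverseˡ e) (eightCycle-inverseʳ e)
    ; consecutive = eight-consecutive e
    ; complete    = λ { (inj₁ arc) → eight-arc e arc ; (inj₂ arc) → cycleEdge-sym (eight-arc e arc) }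
    }

  cayley-decomposition : Decomp (CayAdj m) 8 m
  cayley-decomposition = decomposition (eightCycles red) (eightCycles blue) greenCycles

lemma2p10 : (m : ℕ) .{{_ : NonZero m}} → 5 ≤ m → m % 2 ≡ 1 →
    Decomp (CayAdj m) 8 m
lemma2p10 (suc (suc (suc (suc (suc k))))) _ odd =
  Factors.cayley-decomposition (4 + k) (m≤m+n 4 k) (offset-closes k odd)
lemma2p10 1 (s≤s ()) _
lemma2p10 3 (s≤s (s≤s (s≤s ()))) _
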